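{- Let $p$ be an odd prime, let $\delta,\varphi\in\mathbb{Z}$ satisfy $\delta^2-\delta+1\equiv 0\pmod p$ and $\varphi^2\equiv 2\delta\pmod p$, and let $u,v$ be integers with $u\equiv\varphi\pmod p$ and $v\equiv\delta\pmod p$. Then the sequences $(\alpha_i)_{i\ge1}$, $(\beta_i)_{i\ge 1}$ defined below satisfy, for all $k\ge 0$: $\alpha_{3k+1}\equiv-\varphi$, $\alpha_{3k+2}+\alpha_{3k+3}\equiv\varphi\pmod p$; $\alpha_{9k+2}\equiv\varphi/\delta$, $\alpha_{9k+5}\equiv\alpha_{3k+3}$, $\alpha_{9k+8}\equiv\varphi\delta\pmod p$; $\beta_1\equiv 1$, $\beta_2\equiv\delta$, $\beta_{3k+3}\equiv-\delta$, $\beta_{3k+4}+\beta_{3k+5}\equiv\delta\pmod p$; $\beta_{9k+1}\equiv\beta_{3k+1}$, $\beta_{9k+4}\equiv-1/\delta$, $\beta_{9k+7}\equiv 1\pmod p$.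
   Context: Given $u,v$, define rational numbers $\alpha_i,\beta_i$ ($i\ge 1$) by $\alpha_1=-u$, $\alpha_2=\frac{u(2v-1-u^2)}{v-u^2}$, $\alpha_3=\frac{ -u(v-1)}{v-u^2}$, $\beta_1=1$, $\beta_2=u^2-v$, $\beta_3=\frac{u^2+u^4+v^3-3u^2v}{(v-u^2)^2}$, and for every $k\ge 0$: $\alpha_{3k+4}=-u$, $\beta_{3k+4}=\frac{\beta_{k+2}}{\beta_{3k+3}\beta_{3k+2}}$, $\beta_{3k+5}=u^2-v-\beta_{3k+4}$, $\alpha_{3k+5}=u-\frac{\alpha_{k+2}+uv-\alpha_{3k+2}\beta_{3k+4}}{\beta_{3k+5}}$, $\alpha_{3k+6}=u-\alpha_{3k+5}$, $\beta_{3k+6}=v-\alpha_{3k+5}\alpha_{3k+6}$. Congruences modulo $p$ between rational numbers are understood in the local ring $\mathbb{Z}_{(p)}$ of rationals with denominator prime to $p$; asserting such a congruence for $\alpha_i$ or $\beta_i$ includes that it is well defined (no division by zero) and lies in $\mathbb{Z}_{(p)}$. Division by $\delta$ means multiplication by the inverse of $\delta$ modulo $p$. -}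

module Defs where

open import Data.Nat as ℕ using (ℕ; zero; suc; _≡ᵇ_)
open import Data.Integer as ℤ using (ℤ; +_)
open import Data.Integer.Divisibility as ℤd using ()
open import Data.Rational as ℚ using (ℚ; ↥_; ↧_; 0ℚ; 1ℚ; _÷_; ≢-nonZero)
open import Data.Rational.Properties using (_≟_)
open import Data.Maybe using (Maybe; just; nothing; zipWith; _>>=_)
open import Data.Product using (_×_; _,_; proj₁; proj₂)
open import Data.Bool using (if_then_else_)
open import Data.Empty using (⊥)
open import Relation.Nullary using (¬_; yes; no)

-- Partial rational arithmetic: 'nothing' records a division by zero.

_⊕_ : Maybe ℚ → Maybe ℚ → Maybe ℚ
_⊕_ = zipWith ℚ._+_

_⊖_ : Maybe ℚ → Maybe ℚ → Maybe ℚ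
_⊖_ = zipWith ℚ._-_

_⊗_ : Maybe ℚ → Maybe ℚ → Maybe ℚ
_⊗_ = zipWith ℚ._*_

divℚ : ℚ → ℚ → Maybe ℚ
divℚ x y with y ≟ 0ℚ
... | yes _  = nothing
... | no y≢0 = just ((x ÷ y) {{≢-nonZero y≢0}})

_⊘_ : Maybe ℚ → Maybe ℚ → Maybe ℚ
mx ⊘ my = mx >>= λ x → my >>= λ y → divℚ x y

infixl 6 _⊕_ _⊖_
infixl 7 _⊗_ _⊘_
infix 4 _≋_[mod_] _≡_[mod_]

ι : ℤ → Maybe ℚ
ι z = just (z ℚ./ 1)

-- A table maps indices to (partial) values; 'table u v k' is correct on all
-- indices 1 .. 3k+3 (block k of the recursion adds indices 3k+4,3k+5,3k+6).

Table : Set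
Table = (ℕ → Maybe ℚ) × (ℕ → Maybe ℚ)

initTable : ℤ → ℤ → Table
initTable u v = a , b
  where
  U V : Maybe ℚ
  U = ι u
  V = ι v
  one : Maybe ℚ
  one = just 1ℚ
  a : ℕ → Maybe ℚ
  a 1 = ι (ℤ.- u)
  a 2 = (U ⊗ (ι (+ 2) ⊗ V ⊖ one ⊖ U ⊗ U)) ⊘ (V ⊖ U ⊗ U)
  a 3 = (ι (ℤ.- u) ⊗ (V ⊖ one)) ⊘ (V ⊖ U ⊗ U)
  a _ = nothing
  b : ℕ → Maybe ℚ
  b 1 = one
  b 2 = U ⊗ U ⊖ V
  b 3 = (U ⊗ U ⊕ U ⊗ U ⊗ U ⊗ U ⊕ V ⊗ V ⊗ V ⊖ ι (+ 3) ⊗ U ⊗ U ⊗ V)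
          ⊘ ((V ⊖ U ⊗ U) ⊗ (V ⊖ U ⊗ U))
  b _ = nothing

extend : ℤ → ℤ → ℕ → Table → Table
extend u v k (a , b) = a' , b'
  where
  U V : Maybe ℚ
  U = ι u
  V = ι v
  i4 i5 i6 : ℕ
  i4 = 3 ℕ.* k ℕ.+ 4
  i5 = 3 ℕ.* k ℕ.+ 5
  i6 = 3 ℕ.* k ℕ.+ 6
  β4 β5 α4 α5 α6 β6 : Maybe ℚ
  α4 = ι (ℤ.- u)
  β4 = b (k ℕ.+ 2) ⊘ (b (3 ℕ.* k ℕ.+ 3) ⊗ b (3 ℕ.* k ℕ.+ 2))
  β5 = U ⊗ U ⊖ V ⊖ β4
  α5 = U ⊖ (a (k ℕ.+ 2) ⊕ U ⊗ V ⊖ a (3 ℕ.* k ℕ.+ 2) ⊗ β4) ⊘ β5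
  α6 = U ⊖ α5
  β6 = V ⊖ α5 ⊗ α6
  a' : ℕ → Maybe ℚ
  a' i = if i ≡ᵇ i4 then α4 else if i ≡ᵇ i5 then α5 else if i ≡ᵇ i6 then α6 else a i
  b' : ℕ → Maybe ℚ
  b' i = if i ≡ᵇ i4 then β4 else if i ≡ᵇ i5 then β5 else if i ≡ᵇ i6 then β6 else b i

table : ℤ → ℤ → ℕ → Table
table u v zero    = initTable u v
table u v (suc k) = extend u v k (table u v k)

-- α_i and β_i (table u v i covers index i since i ≤ 3i+3); index 0 unused
α : ℤ → ℤ → ℕ → Maybe ℚ
α u v i = proj₁ (table u v i) i

β : ℤ → ℤ → ℕ → Maybe ℚ
β u v i = proj₂ (table u v i) i

_≡_[mod_] : ℤ → ℤ → ℕ → Set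
a ≡ b [mod p ] = (+ p) ℤd.∣ (a ℤ.- b)

InZp : ℕ → ℚ → Set
InZp p x = ¬ ((+ p) ℤd.∣ (↧ x))

CongQ : ℕ → ℚ → ℚ → Set
CongQ p x y = InZp p x × InZp p y × ((+ p) ℤd.∣ (↥ x ℤ.* ↧ y ℤ.- ↥ y ℤ.* ↧ x))

_≋_[mod_] : Maybe ℚ → Maybe ℚ → ℕ → Set
just x ≋ just y [mod p ] = CongQ p x y
_      ≋ _      [mod p ] = ⊥

DefZp : ℕ → Maybe ℚ → Set
DefZp p (just x) = InZp p x
DefZp p nothing  = ⊥

{-# OPTIONS --safe #-}
module Submission where

-- Everything is reduced modulo p.  A rational in ℤ_(p) is recorded by an integer residue
-- (m ↦ a), and reduction commutes with +, −, × and with division by a unit, so the recursion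
-- can be run on residues, where δ² = δ − 1 (hence δ⁻¹ = 1 − δ) and φ² = 2δ.  Group the indices
-- into blocks 3n+1, 3n+2, 3n+3.  Every block has α-residues (−φ, x, φ − x) and β-residues
-- (y, e, −δ), where x ∈ {φ/δ, φδ} is a root of X² − φX + 2δ and y ∈ {1, −1/δ}.  Block n + 1 is
-- computed from block n and from the entries at index n + 2, which lie in an earlier block;
-- following this dependence, positions 1 and 2 of the blocks 3j, 3j+1, 3j+2 are determined by
-- block j.  The block shape and these ninefold relations are proved together by induction on j.

open import Data.Bool using (true; false; T; if_then_else_)
open import Data.Empty using (⊥-elim)
open import Data.List using (_∷_; [])
open import Data.Maybe using (Maybe; just)
open import Data.Product using (_×_; _,_; proj₁; proj₂)
open import Data.Sum using (_⊎_; inj₁; inj₂)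
import Data.Sum as Sum
open import Data.Unit using (tt)
open import Data.Nat using (ℕ; zero; suc)
open import Data.Nat.Primality using (Prime; euclidsLemma; ¬prime[1])
import Data.Nat.Divisibility as ℕ
import Data.Nat.Properties as ℕP
open import Data.Nat.Tactic.RingSolver using (solve-∀)
open import Data.Integer as ℤ using (ℤ; +_; -_; _-_; +[1+_]; -[1+_])
import Data.Integer.Properties as ℤP
open import Data.Integer.Divisibility.Signed
  using (_∣_; divides; ∣ᵤ⇒∣; ∣⇒∣ᵤ; ∣m∣n⇒∣m+n; ∣n⇒∣m*n; ∣m⇒∣m*n; ∣m⇒∣-m)
open import Data.Integer.Tactic.RingSolver using (solve)
open import Data.Rational as ℚ using (ℚ; mkℚ; ↥_; ↧_; 0ℚ)
import Data.Rational.Properties as ℚP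
open import Relation.Nullary using (¬_; yes; no)
open import Relation.Binary.PropositionalEquality
  using (_≡_; _≢_; refl; sym; trans; cong; cong₂; subst)
open import Defs

module Congruence (p : ℕ) where

  open import Data.Integer using (_+_; _*_)

  infix 4 _≈_

  -- A record, not a definition, so that a and b can be inferred from a proof of a ≈ b.
  record _≈_ (a b : ℤ) : Set where
    constructor ≈-intro
    field p∣a-b : + p ∣ a - b

  ≈-combination : ∀ {a b} c₁ {a₁ b₁} c₂ {a₂ b₂} → a₁ ≈ b₁ → a₂ ≈ b₂ →
            a - b ≡ c₁ * (a₁ - b₁) + c₂ * (a₂ - b₂) → a ≈ b
  ≈-combination c₁ c₂ (≈-intro h₁) (≈-intro h₂) eq =
    ≈-intro (subst (+ p ∣_) (sym eq) (∣m∣n⇒∣m+n (∣n⇒∣m*n c₁ h₁) (∣n⇒∣m*n c₂ h₂)))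

  ≈-combination₃ : ∀ {a b} c₁ {a₁ b₁} c₂ {a₂ b₂} c₃ {a₃ b₃} → a₁ ≈ b₁ → a₂ ≈ b₂ → a₃ ≈ b₃ →
             a - b ≡ c₁ * (a₁ - b₁) + c₂ * (a₂ - b₂) + c₃ * (a₃ - b₃) → a ≈ b
  ≈-combination₃ c₁ c₂ c₃ (≈-intro h₁) (≈-intro h₂) (≈-intro h₃) eq =
    ≈-intro (subst (+ p ∣_) (sym eq)
      (∣m∣n⇒∣m+n (∣m∣n⇒∣m+n (∣n⇒∣m*n c₁ h₁) (∣n⇒∣m*n c₂ h₂)) (∣n⇒∣m*n c₃ h₃)))

  p∣0 : + p ∣ + 0
  p∣0 = divides (+ 0) refl

  ≈-reflexive : ∀ {a b} → a ≡ b → a ≈ b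
  ≈-reflexive {a} refl = ≈-intro (subst (+ p ∣_) (sym (ℤP.+-inverseʳ a)) p∣0)

  ≈-refl : ∀ {a} → a ≈ a
  ≈-refl = ≈-reflexive refl

  ≈-sym : ∀ {a b} → a ≈ b → b ≈ a
  ≈-sym {a} {b} h = ≈-combination (- + 1) (+ 0) h h (solve (a ∷ b ∷ []))

  ≈-trans : ∀ {a b c} → a ≈ b → b ≈ c → a ≈ c
  ≈-trans {a} {b} {c} h g = ≈-combination (+ 1) (+ 1) h g (solve (a ∷ b ∷ c ∷ []))

  +-cong : ∀ {a b c d} → a ≈ b → c ≈ d → a + c ≈ b + d
  +-cong {a} {b} {c} {d} h g = ≈-combination (+ 1) (+ 1) h g (solve (a ∷ b ∷ c ∷ d ∷ []))

  *-cong : ∀ {a b c d} → a ≈ b → c ≈ d → a * c ≈ b * d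
  *-cong {a} {b} {c} {d} h g = ≈-combination c b h g (solve (a ∷ b ∷ c ∷ d ∷ []))

  neg-cong : ∀ {a b} → a ≈ b → - a ≈ - b
  neg-cong {a} {b} h = ≈-combination (- + 1) (+ 0) h h (solve (a ∷ b ∷ []))

  ∣⇒≈0 : ∀ {a} → + p ∣ a → a ≈ + 0
  ∣⇒≈0 {a} h = ≈-intro (subst (+ p ∣_) (sym (ℤP.+-identityʳ a)) h)

  ≈0⇒∣ : ∀ {a} → a ≈ + 0 → + p ∣ a
  ≈0⇒∣ {a} (≈-intro h) = subst (+ p ∣_) (ℤP.+-identityʳ a) h

  -‿cong : ∀ {a b c d} → a ≈ b → c ≈ d → a - c ≈ b - d
  -‿cong h g = +-cong h (neg-cong g)

  *-inverses : ∀ {a a′ b b′} → a * a′ ≈ + 1 → b * b′ ≈ + 1 → (a * b) * (a′ * b′) ≈ + 1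
  *-inverses {a} {a′} {b} {b′} h g =
    ≈-combination (b * b′) (+ 1) h g (solve (a ∷ a′ ∷ b ∷ b′ ∷ []))

  inverse-unique : ∀ {a b c} → a * b ≈ + 1 → a * c ≈ + 1 → b ≈ c
  inverse-unique {a} {b} {c} h g = ≈-combination c (- b) h g (solve (a ∷ b ∷ c ∷ []))

  *-inverse-cancel : ∀ {a a′} c → a * a′ ≈ + 1 → a * (c * a′) ≈ c
  *-inverse-cancel {a} {a′} c h = ≈-combination c (+ 0) h h (solve (a ∷ a′ ∷ c ∷ []))

  *-identityʳ-≈ : ∀ {a b} → b ≈ + 1 → a * b ≈ a
  *-identityʳ-≈ {a} {b} h = ≈-combination a (+ 0) h h (solve (a ∷ b ∷ []))

  ≡[mod]⇒≈ : ∀ {a b} → a ≡ b [mod p ] → a ≈ b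
  ≡[mod]⇒≈ h = ≈-intro (∣ᵤ⇒∣ h)

module Reduction (p : ℕ) (p-prime : Prime p) where

  open import Data.Integer using (_+_; _*_)
  open Congruence p

  p∣*⇒p∣⊎p∣ : ∀ a b → + p ∣ a * b → + p ∣ a ⊎ + p ∣ b
  p∣*⇒p∣⊎p∣ a b h
    with euclidsLemma ℤ.∣ a ∣ ℤ.∣ b ∣ p-prime (subst (p ℕ.∣_) (ℤP.abs-* a b) (∣⇒∣ᵤ h))
  ... | inj₁ p∣a = inj₁ (∣ᵤ⇒∣ p∣a)
  ... | inj₂ p∣b = inj₂ (∣ᵤ⇒∣ p∣b)

  p∤1 : ¬ (+ p ∣ + 1)
  p∤1 h with ℕ.∣1⇒≡1 (∣⇒∣ᵤ h)
  ... | refl = ¬prime[1] p-prime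

  p∤* : ∀ {a b} → ¬ (+ p ∣ a) → ¬ (+ p ∣ b) → ¬ (+ p ∣ a * b)
  p∤* {a} {b} p∤a p∤b h with p∣*⇒p∣⊎p∣ a b h
  ... | inj₁ p∣a = p∤a p∣a
  ... | inj₂ p∣b = p∤b p∣b

  *-cancelʳ-≈ : ∀ {a b c} → ¬ (+ p ∣ c) → a * c ≈ b * c → a ≈ b
  *-cancelʳ-≈ {a} {b} {c} p∤c ac≈bc
    with p∣*⇒p∣⊎p∣ (a - b) c (≈0⇒∣ (≈-combination (+ 1) (+ 0) ac≈bc ac≈bc
                                        (solve (a ∷ b ∷ c ∷ []))))
  ... | inj₁ p∣a-b = ≈-intro p∣a-b
  ... | inj₂ p∣c = ⊥-elim (p∤c p∣c)

  invertible⇒p∤ : ∀ {b c} → b * c ≈ + 1 → ¬ (+ p ∣ b)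
  invertible⇒p∤ {b} {c} bc≈1 p∣b =
    p∤1 (≈0⇒∣ (≈-trans (≈-sym bc≈1) (≈-combination c (+ 0) (∣⇒≈0 p∣b) bc≈1 (solve (b ∷ c ∷ [])))))

  +-fractions : ∀ {n₁ d₁ n₂ d₂ a b} → n₁ ≈ a * d₁ → n₂ ≈ b * d₂ →
                n₁ * d₂ + n₂ * d₁ ≈ (a + b) * (d₁ * d₂)
  +-fractions {n₁} {d₁} {n₂} {d₂} {a} {b} h₁ h₂ =
    ≈-combination d₂ d₁ h₁ h₂ (solve (n₁ ∷ d₁ ∷ n₂ ∷ d₂ ∷ a ∷ b ∷ []))

  *-fractions : ∀ {n₁ d₁ n₂ d₂ a b} → n₁ ≈ a * d₁ → n₂ ≈ b * d₂ →
                n₁ * n₂ ≈ (a * b) * (d₁ * d₂)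
  *-fractions {n₁} {d₁} {n₂} {d₂} {a} {b} h₁ h₂ =
    ≈-combination n₂ (a * d₁) h₁ h₂ (solve (n₁ ∷ d₁ ∷ n₂ ∷ d₂ ∷ a ∷ b ∷ []))

  neg-fraction : ∀ {n d a} → n ≈ a * d → - n ≈ - a * d
  neg-fraction {n} {d} {a} h = ≈-combination (- + 1) (+ 0) h h (solve (n ∷ d ∷ a ∷ []))

  inverse-fraction : ∀ {n d b c} → n ≈ b * d → b * c ≈ + 1 → d ≈ c * n
  inverse-fraction {n} {d} {b} {c} h bc≈1 =
    ≈-combination (- c) (- d) h bc≈1 (solve (n ∷ d ∷ b ∷ c ∷ []))

  numerator-∤ : ∀ {n d b c} → ¬ (+ p ∣ d) → n ≈ b * d → b * c ≈ + 1 → ¬ (+ p ∣ n)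
  numerator-∤ {n} {d} {b} {c} p∤d h bc≈1 p∣n =
    p∤* (invertible⇒p∤ {b} {c} bc≈1) p∤d (≈0⇒∣ (≈-trans (≈-sym h) (∣⇒≈0 p∣n)))

  cross-multiplication : ∀ {n₁ d₁ n₂ d₂ a} → n₁ ≈ a * d₁ → n₂ ≈ a * d₂ → n₁ * d₂ ≈ n₂ * d₁
  cross-multiplication {n₁} {d₁} {n₂} {d₂} {a} h₁ h₂ =
    ≈-combination d₂ (- d₁) h₁ h₂ (solve (n₁ ∷ d₁ ∷ n₂ ∷ d₂ ∷ a ∷ []))

  infix 4 _↦_

  data _↦_ : Maybe ℚ → ℤ → Set where
    reduces : ∀ {x a} → ¬ (+ p ∣ ↧ x) → ↥ x ≈ a * ↧ x → just x ↦ a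

  -- ℚP.↥-/, ↥-+ and ↥-* describe a normalised result through an unnormalised fraction n / d
  -- and the common factor g cancelled by the normalisation.
  ↦-from-scaling : ∀ {z a g n d} → ↥ z * g ≡ n → ↧ z * g ≡ d →
                   ¬ (+ p ∣ d) → n ≈ a * d → just z ↦ a
  ↦-from-scaling {z} {a} {g} refl refl p∤d h =
    reduces (λ p∣↧z → p∤d (∣m⇒∣m*n g p∣↧z))
            (*-cancelʳ-≈ (λ p∣g → p∤d (∣n⇒∣m*n (↧ z) p∣g))
                         (≈-trans h (≈-reflexive (sym (ℤP.*-assoc a (↧ z) g)))))

  ↦-resp-≈ : ∀ {m a b} → m ↦ a → a ≈ b → m ↦ b
  ↦-resp-≈ (reduces p∤d h) a≈b = reduces p∤d (≈-trans h (*-cong a≈b ≈-refl))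

  ↦-unique : ∀ {m a b} → m ↦ a → m ↦ b → a ≈ b
  ↦-unique (reduces p∤d h) (reduces _ g) = *-cancelʳ-≈ p∤d (≈-trans (≈-sym h) g)

  ι-↦ : ∀ a → ι a ↦ a
  ι-↦ a = ↦-from-scaling (ℚP.↥-/ a 1) (ℚP.↧-/ a 1) p∤1
                         (≈-reflexive (sym (ℤP.*-identityʳ a)))

  ⊕-↦ : ∀ {m n a b} → m ↦ a → n ↦ b → m ⊕ n ↦ a + b
  ⊕-↦ {a = a} {b} (reduces {x} p∤x hx) (reduces {y} p∤y hy) =
    ↦-from-scaling (ℚP.↥-+ x y) (ℚP.↧-+ x y) (p∤* p∤x p∤y) (+-fractions {a = a} {b} hx hy)

  ⊗-↦ : ∀ {m n a b} → m ↦ a → n ↦ b → m ⊗ n ↦ a * b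
  ⊗-↦ {a = a} {b} (reduces {x} p∤x hx) (reduces {y} p∤y hy) =
    ↦-from-scaling (ℚP.↥-* x y) (ℚP.↧-* x y) (p∤* p∤x p∤y) (*-fractions {a = a} {b} hx hy)

  neg-↦ : ∀ {x a} → just x ↦ a → just (ℚ.- x) ↦ - a
  neg-↦ {x} {a} (reduces p∤x hx) =
    ↦-from-scaling (trans (ℤP.*-identityʳ _) (ℚP.↥-neg x))
                   (trans (ℤP.*-identityʳ _) (ℚP.↧-neg x)) p∤x (neg-fraction {a = a} hx)

  ⊖-↦ : ∀ {m n a b} → m ↦ a → n ↦ b → m ⊖ n ↦ a - b
  ⊖-↦ rm@(reduces _ _) rn@(reduces _ _) = ⊕-↦ rm (neg-↦ rn)

  1/-↦ : ∀ {y b c} .{{_ : ℚ.NonZero y}} → just y ↦ b → b * c ≈ + 1 → just (ℚ.1/ y) ↦ c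
  1/-↦ {mkℚ +[1+ n ] d _} {b} {c} (reduces p∤d h) bc≈1 =
    reduces (numerator-∤ {b = b} {c} p∤d h bc≈1) (inverse-fraction {b = b} h bc≈1)
  1/-↦ {mkℚ -[1+ n ] d _} {b} {c} (reduces p∤d h) bc≈1 =
    reduces (λ p∣n → numerator-∤ {b = b} {c} p∤d h bc≈1
                       (subst (+ p ∣_) (ℤP.neg-involutive _) (∣m⇒∣-m p∣n)))
            (≈-trans (neg-cong (inverse-fraction {b = b} h bc≈1))
                     (≈-reflexive (ℤP.neg-distribʳ-* c -[1+ n ])))

  ⊘-↦ : ∀ {m n a b c} → m ↦ a → n ↦ b → b * c ≈ + 1 → m ⊘ n ↦ a * c
  ⊘-↦ {b = b} {c} rm@(reduces _ _) rn@(reduces {y} p∤d h) bc≈1 with y ℚP.≟ 0ℚ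
  ... | yes refl = ⊥-elim (numerator-∤ {b = b} {c} p∤d h bc≈1 p∣0)
  ... | no y≢0   = ⊗-↦ rm (1/-↦ {{ℚ.≢-nonZero y≢0}} rn bc≈1)

  ↦⇒DefZp : ∀ {m a} → m ↦ a → DefZp p m
  ↦⇒DefZp (reduces p∤d _) = λ p∣d → p∤d (∣ᵤ⇒∣ p∣d)

  ↦⇒≋ : ∀ {m n a} → m ↦ a → n ↦ a → m ≋ n [mod p ]
  ↦⇒≋ {a = a} rx@(reduces _ hx) ry@(reduces _ hy) =
    ↦⇒DefZp rx , ↦⇒DefZp ry , ∣⇒∣ᵤ (_≈_.p∣a-b (cross-multiplication {a = a} hx hy))

module Residues (p : ℕ) (δ φ : ℤ)
  (δ²-δ+1≡0 : δ ℤ.* δ - δ ℤ.+ + 1 ≡ + 0 [mod p ]) (φ²≡2δ : φ ℤ.* φ ≡ + 2 ℤ.* δ [mod p ]) where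

  open import Data.Integer using (_+_; _*_)
  open Congruence p

  -- The coefficients cᵢ used below are the quotients of a − b by the Gröbner basis
  -- {δ² − δ + 1, φ² − 2δ}.
  by-relations : ∀ {a b} c₁ c₂ →
                 a - b ≡ c₁ * (δ * δ - δ + + 1 - + 0) + c₂ * (φ * φ - + 2 * δ) → a ≈ b
  by-relations c₁ c₂ =
    ≈-combination c₁ c₂ (≡[mod]⇒≈ {δ * δ - δ + + 1} {+ 0} δ²-δ+1≡0)
                  (≡[mod]⇒≈ {φ * φ} {+ 2 * δ} φ²≡2δ)

  by-relations-and : ∀ {a b a₃ b₃} c₁ c₂ c₃ → a₃ ≈ b₃ →
                     a - b ≡ c₁ * (δ * δ - δ + + 1 - + 0) + c₂ * (φ * φ - + 2 * δ)
                             + c₃ * (a₃ - b₃) →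
                     a ≈ b
  by-relations-and c₁ c₂ c₃ =
    ≈-combination₃ c₁ c₂ c₃ (≡[mod]⇒≈ {δ * δ - δ + + 1} {+ 0} δ²-δ+1≡0)
                      (≡[mod]⇒≈ {φ * φ} {+ 2 * δ} φ²≡2δ)

  -- r₁ is φ/δ modulo p, and r₁, r₂ are the roots of X² − φX + 2δ.
  r₁ r₂ : ℤ
  r₁ = φ * (+ 1 - δ)
  r₂ = φ * δ

  IsRoot : ℤ → Set
  IsRoot a = a ≈ r₁ ⊎ a ≈ r₂

  δ*[1-δ]≈1 : δ * (+ 1 - δ) ≈ + 1
  δ*[1-δ]≈1 = by-relations (- + 1) (+ 0) (solve (δ ∷ φ ∷ []))

  -δ*[δ-1]≈1 : - δ * (δ - + 1) ≈ + 1
  -δ*[δ-1]≈1 = by-relations (- + 1) (+ 0) (solve (δ ∷ φ ∷ []))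

  [δ-1]*-δ≈1 : (δ - + 1) * - δ ≈ + 1
  [δ-1]*-δ≈1 = by-relations (- + 1) (+ 0) (solve (δ ∷ φ ∷ []))

  [δ-1]²≈-δ : (δ - + 1) * (δ - + 1) ≈ - δ
  [δ-1]²≈-δ = by-relations (+ 1) (+ 0) (solve (δ ∷ φ ∷ []))

  φ²-δ≈δ : φ * φ - δ ≈ δ
  φ²-δ≈δ = by-relations (+ 0) (+ 1) (solve (δ ∷ φ ∷ []))

  δ-φ²≈-δ : δ - φ * φ ≈ - δ
  δ-φ²≈-δ = by-relations (+ 0) (- + 1) (solve (δ ∷ φ ∷ []))

  r₁*r₂≈2δ : r₁ * r₂ ≈ + 2 * δ
  r₁*r₂≈2δ = by-relations {φ * (+ 1 - δ) * (φ * δ)} (- (+ 2 * δ)) (δ - δ * δ) (solve (δ ∷ φ ∷ []))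

  root-complement : ∀ {a} → IsRoot a → IsRoot (φ - a)
  root-complement (inj₁ a≈r₁) = inj₂ (≈-trans (-‿cong (≈-refl {φ}) a≈r₁) (≈-reflexive φ-r₁≡r₂))
    where
    φ-r₁≡r₂ : φ - φ * (+ 1 - δ) ≡ φ * δ
    φ-r₁≡r₂ = solve (δ ∷ φ ∷ [])
  root-complement (inj₂ a≈r₂) = inj₁ (≈-trans (-‿cong (≈-refl {φ}) a≈r₂) (≈-reflexive φ-r₂≡r₁))
    where
    φ-r₂≡r₁ : φ - φ * δ ≡ φ * (+ 1 - δ)
    φ-r₂≡r₁ = solve (δ ∷ φ ∷ [])

  δ-a[φ-a]≈-δ : ∀ {a} → IsRoot a → δ - a * (φ - a) ≈ - δ
  δ-a[φ-a]≈-δ a-root =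
    ≈-trans (-‿cong (≈-refl {δ}) (≈-trans (root-product a-root) r₁*r₂≈2δ)) (≈-reflexive δ-2δ≡-δ)
    where
    δ-2δ≡-δ : δ - + 2 * δ ≡ - δ
    δ-2δ≡-δ = solve (δ ∷ [])
    root-product : ∀ {a} → IsRoot a → a * (φ - a) ≈ r₁ * r₂
    root-product (inj₁ a≈r₁) =
      ≈-trans (*-cong a≈r₁ (-‿cong (≈-refl {φ}) a≈r₁)) (≈-reflexive r₁*[φ-r₁]≡r₁*r₂)
      where
      r₁*[φ-r₁]≡r₁*r₂ : φ * (+ 1 - δ) * (φ - φ * (+ 1 - δ)) ≡ φ * (+ 1 - δ) * (φ * δ)
      r₁*[φ-r₁]≡r₁*r₂ = solve (δ ∷ φ ∷ [])
    root-product (inj₂ a≈r₂) =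
      ≈-trans (*-cong a≈r₂ (-‿cong (≈-refl {φ}) a≈r₂)) (≈-reflexive r₂*[φ-r₂]≡r₁*r₂)
      where
      r₂*[φ-r₂]≡r₁*r₂ : φ * δ * (φ - φ * δ) ≡ φ * (+ 1 - δ) * (φ * δ)
      r₂*[φ-r₂]≡r₁*r₂ = solve (δ ∷ φ ∷ [])

  α₂-numerator≈-φ : φ * (+ 2 * δ - + 1 - φ * φ) ≈ - φ
  α₂-numerator≈-φ = by-relations (+ 0) (- φ) (solve (δ ∷ φ ∷ []))

  α₃≈φ-r₁ : - φ * (δ - + 1) * (δ - + 1) ≈ φ - r₁
  α₃≈φ-r₁ = by-relations {b = φ - φ * (+ 1 - δ)} (- φ) (+ 0) (solve (δ ∷ φ ∷ []))

  β₃-numerator≈1 : φ * φ + φ * φ * φ * φ + δ * δ * δ - + 3 * φ * φ * δ ≈ + 1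
  β₃-numerator≈1 = by-relations (- + 1 + δ) (+ 1 + φ * φ - δ) (solve (δ ∷ φ ∷ []))

  child₁-α₂ : ∀ x → φ - (x + φ * δ - r₁ * (δ - + 1)) * + 1 ≈ φ - x
  child₁-α₂ x = by-relations {φ - (x + φ * δ - φ * (+ 1 - δ) * (δ - + 1)) * + 1}
                             (- φ) (+ 0) (solve (δ ∷ φ ∷ x ∷ []))

  child₂-α₂ : ∀ w → φ - (w + φ * δ - w * + 1) * - δ ≈ r₂
  child₂-α₂ w = by-relations {b = φ * δ} φ (+ 0) (solve (δ ∷ φ ∷ w ∷ []))

  complement⁻¹ : ∀ {y} → y ≈ + 1 ⊎ y ≈ δ - + 1 → ℤ
  complement⁻¹ (inj₁ _) = - δ
  complement⁻¹ (inj₂ _) = + 1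

  complement-inverse : ∀ {y} (y-cases : y ≈ + 1 ⊎ y ≈ δ - + 1) →
                       (δ - y) * complement⁻¹ y-cases ≈ + 1
  complement-inverse {y} (inj₁ y≈1) =
    by-relations-and {(δ - y) * - δ} (- + 1) (+ 0) δ y≈1 (solve (δ ∷ φ ∷ y ∷ []))
  complement-inverse {y} (inj₂ y≈δ-1) =
    by-relations-and {(δ - y) * + 1} (+ 0) (+ 0) (- + 1) y≈δ-1 (solve (δ ∷ φ ∷ y ∷ []))

  child₀-α₂ : ∀ {y} (y-cases : y ≈ + 1 ⊎ y ≈ δ - + 1) →
              φ - (- φ + φ * δ - r₂ * y) * complement⁻¹ y-cases ≈ r₁
  child₀-α₂ {y} (inj₁ y≈1) =
    by-relations-and {φ - (- φ + φ * δ - φ * δ * y) * - δ} {φ * (+ 1 - δ)}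
                     (+ 0) (+ 0) (- (φ * δ * δ)) y≈1 (solve (δ ∷ φ ∷ y ∷ []))
  child₀-α₂ {y} (inj₂ y≈δ-1) =
    by-relations-and {φ - (- φ + φ * δ - φ * δ * y) * + 1} {φ * (+ 1 - δ)}
                     φ (+ 0) (φ * δ) y≈δ-1 (solve (δ ∷ φ ∷ y ∷ []))

  r₁≈φ*δ⁻¹ : ∀ {δ⁻¹} → δ * δ⁻¹ ≈ + 1 → r₁ ≈ φ * δ⁻¹
  r₁≈φ*δ⁻¹ δδ⁻¹≈1 = *-cong (≈-refl {φ}) (inverse-unique {δ} δ*[1-δ]≈1 δδ⁻¹≈1)

  δ-1≈-δ⁻¹ : ∀ {δ⁻¹} → δ * δ⁻¹ ≈ + 1 → δ - + 1 ≈ - δ⁻¹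
  δ-1≈-δ⁻¹ δδ⁻¹≈1 =
    ≈-trans (≈-reflexive δ-1≡-[1-δ]) (neg-cong (inverse-unique {δ} δ*[1-δ]≈1 δδ⁻¹≈1))
    where
    δ-1≡-[1-δ] : δ - + 1 ≡ - (+ 1 - δ)
    δ-1≡-[1-δ] = solve (δ ∷ [])

open import Data.Nat using (_+_; _*_; _≤′_; _<_; _≡ᵇ_; _<ᵇ_; s≤s; z<s; s<s; ≤′-refl; ≤′-step)

if-≡ᵇ-≢ : ∀ {A : Set} {x y : A} i n → i ≢ n → (if i ≡ᵇ n then x else y) ≡ y
if-≡ᵇ-≢ i n i≢n with i ≡ᵇ n in eq
... | true  = ⊥-elim (i≢n (ℕP.≡ᵇ⇒≡ i n (subst T (sym eq) tt)))
... | false = refl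

if-≡ᵇ-≡ : ∀ {A : Set} {x y : A} i n → i ≡ n → (if i ≡ᵇ n then x else y) ≡ x
if-≡ᵇ-≡ i n i≡n with i ≡ᵇ n in eq
... | true  = refl
... | false = ⊥-elim (subst T eq (ℕP.≡⇒≡ᵇ i n i≡n))

index< : ∀ k r s → T (r <ᵇ s) → 3 * k + r < 3 * k + s
index< k r s r<s = ℕP.+-monoʳ-< (3 * k) (ℕP.<ᵇ⇒< r s r<s)

next-block : ∀ k r → 3 * suc k + r ≡ 3 * k + (3 + r)
next-block = solve-∀

module BlockUpdate {A : Set} (k : ℕ) (x y z : A) (f : ℕ → A) where

  update : ℕ → A
  update i = if i ≡ᵇ 3 * k + 4 then x else if i ≡ᵇ 3 * k + 5 then y
             else if i ≡ᵇ 3 * k + 6 then z else f i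

  update-old : ∀ i → i < 3 * k + 4 → update i ≡ f i
  update-old i i<4 =
    trans (if-≡ᵇ-≢ i _ (ℕP.<⇒≢ i<4))
      (trans (if-≡ᵇ-≢ i _ (ℕP.<⇒≢ (ℕP.<-trans i<4 (index< k 4 5 tt))))
             (if-≡ᵇ-≢ i _ (ℕP.<⇒≢ (ℕP.<-trans i<4 (index< k 4 6 tt)))))

  update-first : update (3 * suc k + 1) ≡ x
  update-first = if-≡ᵇ-≡ _ _ (next-block k 1)

  update-second : update (3 * suc k + 2) ≡ y
  update-second rewrite next-block k 2 =
    trans (if-≡ᵇ-≢ _ _ (ℕP.>⇒≢ (index< k 4 5 tt))) (if-≡ᵇ-≡ (3 * k + 5) _ refl)

  update-third : update (3 * suc k + 3) ≡ z
  update-third rewrite next-block k 3 =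
    trans (if-≡ᵇ-≢ _ _ (ℕP.>⇒≢ (index< k 4 6 tt)))
      (trans (if-≡ᵇ-≢ _ _ (ℕP.>⇒≢ (index< k 5 6 tt))) (if-≡ᵇ-≡ (3 * k + 6) _ refl))

at : ℕ → Table → Maybe ℚ × Maybe ℚ
at i t = proj₁ t i , proj₂ t i

module Unfolding (u v : ℤ) where

  extend-old : ∀ k t i → i < 3 * k + 4 → at i (extend u v k t) ≡ at i t
  extend-old k t i i<4 = cong₂ _,_ (BlockUpdate.update-old k _ _ _ (proj₁ t) i i<4)
                                   (BlockUpdate.update-old k _ _ _ (proj₂ t) i i<4)

  table-stable : ∀ {k l} i → k ≤′ l → i < 3 * k + 4 → at i (table u v l) ≡ at i (table u v k)
  table-stable i ≤′-refl i<4 = refl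
  table-stable {k} {suc l} i (≤′-step k≤l) i<4 =
    trans (extend-old l (table u v l) i (ℕP.<-≤-trans i<4 3k+4≤3l+4)) (table-stable i k≤l i<4)
    where 3k+4≤3l+4 = ℕP.+-monoˡ-≤ 4 (ℕP.*-monoʳ-≤ 3 (ℕP.≤′⇒≤ k≤l))

  at-table : ∀ k i → i < 3 * k + 4 → at i (table u v i) ≡ at i (table u v k)
  at-table k i i<4 with ℕP.≤-total k i
  ... | inj₁ k≤i = table-stable i (ℕP.≤⇒≤′ k≤i) i<4
  ... | inj₂ i≤k = sym (table-stable i (ℕP.≤⇒≤′ i≤k) i<3i+4)
    where i<3i+4 = ℕP.≤-<-trans (ℕP.m≤n*m i 3) (ℕP.m<m+n (3 * i) z<s)

  α-table : ∀ k i → i < 3 * k + 4 → α u v i ≡ proj₁ (table u v k) i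
  α-table k i i<4 = cong proj₁ (at-table k i i<4)

  β-table : ∀ k i → i < 3 * k + 4 → β u v i ≡ proj₂ (table u v k) i
  β-table k i i<4 = cong proj₂ (at-table k i i<4)

  private
    αₜ βₜ : ℕ → ℕ → Maybe ℚ
    αₜ k = proj₁ (table u v k)
    βₜ k = proj₂ (table u v k)

    α-new : ∀ k r → T (r <ᵇ 4) → α u v (3 * suc k + r) ≡ αₜ (suc k) (3 * suc k + r)
    α-new k r r<4 = α-table (suc k) _ (index< (suc k) r 4 r<4)

    β-new : ∀ k r → T (r <ᵇ 4) → β u v (3 * suc k + r) ≡ βₜ (suc k) (3 * suc k + r)
    β-new k r r<4 = β-table (suc k) _ (index< (suc k) r 4 r<4)

    α-new⁻¹ : ∀ k r {x} → T (r <ᵇ 4) → αₜ (suc k) (3 * suc k + r) ≡ x → x ≡ α u v (3 * suc k + r)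
    α-new⁻¹ k r r<4 eq = sym (trans (α-new k r r<4) eq)

    β-new⁻¹ : ∀ k r {x} → T (r <ᵇ 4) → βₜ (suc k) (3 * suc k + r) ≡ x → x ≡ β u v (3 * suc k + r)
    β-new⁻¹ k r r<4 eq = sym (trans (β-new k r r<4) eq)

    α-old : ∀ k i → i < 3 * k + 4 → αₜ k i ≡ α u v i
    α-old k i i<4 = sym (α-table k i i<4)

    β-old : ∀ k i → i < 3 * k + 4 → βₜ k i ≡ β u v i
    β-old k i i<4 = sym (β-table k i i<4)

    k+2<3k+4 : ∀ k → k + 2 < 3 * k + 4
    k+2<3k+4 k = ℕP.≤-<-trans (ℕP.+-monoˡ-≤ 2 (ℕP.m≤n*m k 3)) (index< k 2 4 tt)

  α-first : ∀ k → α u v (3 * suc k + 1) ≡ ι (- u)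
  α-first k = trans (α-new k 1 tt) (BlockUpdate.update-first k _ _ _ (αₜ k))

  β-first : ∀ k → β u v (3 * suc k + 1) ≡ β u v (k + 2) ⊘ (β u v (3 * k + 3) ⊗ β u v (3 * k + 2))
  β-first k =
    trans (β-new k 1 tt)
      (trans (BlockUpdate.update-first k _ _ _ (βₜ k))
             (cong₂ _⊘_ (β-old k _ (k+2<3k+4 k))
                        (cong₂ _⊗_ (β-old k _ (index< k 3 4 tt)) (β-old k _ (index< k 2 4 tt)))))

  β-second : ∀ k → β u v (3 * suc k + 2) ≡ ι u ⊗ ι u ⊖ ι v ⊖ β u v (3 * suc k + 1)
  β-second k =
    trans (β-new k 2 tt)
      (trans (BlockUpdate.update-second k _ _ _ (βₜ k))
             (cong (ι u ⊗ ι u ⊖ ι v ⊖_)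
                   (β-new⁻¹ k 1 tt (BlockUpdate.update-first k _ _ _ (βₜ k)))))

  α-second : ∀ k → α u v (3 * suc k + 2)
                 ≡ ι u ⊖ (α u v (k + 2) ⊕ ι u ⊗ ι v ⊖ α u v (3 * k + 2) ⊗ β u v (3 * suc k + 1))
                         ⊘ β u v (3 * suc k + 2)
  α-second k =
    trans (α-new k 2 tt)
      (trans (BlockUpdate.update-second k _ _ _ (αₜ k))
             (cong₂ (λ n d → ι u ⊖ n ⊘ d)
                    (cong₂ _⊖_ (cong (_⊕ ι u ⊗ ι v) (α-old k _ (k+2<3k+4 k)))
                               (cong₂ _⊗_ (α-old k _ (index< k 2 4 tt))
                                 (β-new⁻¹ k 1 tt (BlockUpdate.update-first k _ _ _ (βₜ k)))))
                    (β-new⁻¹ k 2 tt (BlockUpdate.update-second k _ _ _ (βₜ k)))))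

  α-third : ∀ k → α u v (3 * suc k + 3) ≡ ι u ⊖ α u v (3 * suc k + 2)
  α-third k =
    trans (α-new k 3 tt)
      (trans (BlockUpdate.update-third k _ _ _ (αₜ k))
             (cong (ι u ⊖_) (α-new⁻¹ k 2 tt (BlockUpdate.update-second k _ _ _ (αₜ k)))))

  β-third : ∀ k → β u v (3 * suc k + 3) ≡ ι v ⊖ α u v (3 * suc k + 2) ⊗ α u v (3 * suc k + 3)
  β-third k =
    trans (β-new k 3 tt)
      (trans (BlockUpdate.update-third k _ _ _ (βₜ k))
             (cong₂ (λ x y → ι v ⊖ x ⊗ y)
                    (α-new⁻¹ k 2 tt (BlockUpdate.update-second k _ _ _ (αₜ k)))
                    (α-new⁻¹ k 3 tt (BlockUpdate.update-third k _ _ _ (αₜ k)))))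

module Blocks (p : ℕ) (p-prime : Prime p) (δ φ u v : ℤ)
  (δ²-δ+1≡0 : δ ℤ.* δ - δ ℤ.+ + 1 ≡ + 0 [mod p ]) (φ²≡2δ : φ ℤ.* φ ≡ + 2 ℤ.* δ [mod p ])
  (u≡φ : u ≡ φ [mod p ]) (v≡δ : v ≡ δ [mod p ]) where

  open Congruence p
  open Reduction p p-prime
  open Residues p δ φ δ²-δ+1≡0 φ²≡2δ
  open Unfolding u v

  unfold : ∀ {m n a} → m ≡ n → n ↦ a → m ↦ a
  unfold refl r = r

  reindex : ∀ (f : ℕ → Maybe ℚ) {i j a} → i ≡ j → f i ↦ a → f j ↦ a
  reindex f refl r = r

  ι-u↦φ : ι u ↦ φ
  ι-u↦φ = ↦-resp-≈ (ι-↦ u) (≡[mod]⇒≈ {u} {φ} u≡φ)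

  ι-v↦δ : ι v ↦ δ
  ι-v↦δ = ↦-resp-≈ (ι-↦ v) (≡[mod]⇒≈ {v} {δ} v≡δ)

  ι-[-u]↦-φ : ι (- u) ↦ - φ
  ι-[-u]↦-φ = ↦-resp-≈ (ι-↦ (- u)) (neg-cong (≡[mod]⇒≈ {u} {φ} u≡φ))

  record Block (n : ℕ) : Set where
    field
      x y e e⁻¹ : ℤ
      α₁ : α u v (3 * n + 1) ↦ - φ
      α₂ : α u v (3 * n + 2) ↦ x
      α₃ : α u v (3 * n + 3) ↦ φ - x
      β₁ : β u v (3 * n + 1) ↦ y
      β₂ : β u v (3 * n + 2) ↦ e
      β₃ : β u v (3 * n + 3) ↦ - δ
      x-root : IsRoot x
      y-cases : y ≈ + 1 ⊎ y ≈ δ - + 1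
      e-inverse : e ℤ.* e⁻¹ ≈ + 1
      -- Block 0, with y = 1 and e = δ, is the only exception.
      e-complement : n ≡ 0 ⊎ e ≈ δ - y

  complement-of-suc : ∀ {n} (B : Block (suc n)) → Block.e B ≈ δ - Block.y B
  complement-of-suc B with Block.e-complement B
  ... | inj₂ e≈δ-y = e≈δ-y

  -- (δ − 1) t⁻¹ is the inverse of the residue −δ t of β (3k+3) β (3k+2).
  block-step : ∀ k {s w t t⁻¹ x y c a} →
               β u v (k + 2) ↦ s → α u v (k + 2) ↦ w →
               β u v (3 * k + 2) ↦ t → t ℤ.* t⁻¹ ≈ + 1 →
               β u v (3 * k + 3) ↦ - δ → α u v (3 * k + 2) ↦ x →
               s ℤ.* ((δ - + 1) ℤ.* t⁻¹) ≈ y → y ≈ + 1 ⊎ y ≈ δ - + 1 → (δ - y) ℤ.* c ≈ + 1 →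
               φ - (w ℤ.+ φ ℤ.* δ - x ℤ.* y) ℤ.* c ≈ a → IsRoot a →
               Block (suc k)
  block-step k {t = t} {t⁻¹} {y = y} {c} {a}
             β[k+2] α[k+2] β[3k+2] t-inverse β[3k+3] α[3k+2] y≈ y-cases c-inverse a≈ a-root =
    record
      { α₁ = unfold (α-first k) ι-[-u]↦-φ
      ; α₂ = α₂
      ; α₃ = α₃
      ; β₁ = β₁
      ; β₂ = β₂
      ; β₃ = unfold (β-third k)
               (↦-resp-≈ (⊖-↦ ι-v↦δ (⊗-↦ α₂ α₃))
                 (δ-a[φ-a]≈-δ a-root))
      ; x-root = a-root
      ; y-cases = y-cases
      ; e-inverse = c-inverse
      ; e-complement = inj₂ ≈-refl
      }
    where
    β₁ : β u v (3 * suc k + 1) ↦ y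
    β₁ = unfold (β-first k)
           (↦-resp-≈ (⊘-↦ {c = (δ - + 1) ℤ.* t⁻¹} β[k+2] (⊗-↦ β[3k+3] β[3k+2])
                          (*-inverses { - δ} {δ - + 1} {t} {t⁻¹} -δ*[δ-1]≈1 t-inverse))
                     y≈)
    β₂ : β u v (3 * suc k + 2) ↦ δ - y
    β₂ = unfold (β-second k)
           (↦-resp-≈ (⊖-↦ (⊖-↦ (⊗-↦ ι-u↦φ ι-u↦φ) ι-v↦δ) β₁) (-‿cong φ²-δ≈δ (≈-refl {y})))
    α₂ : α u v (3 * suc k + 2) ↦ a
    α₂ = unfold (α-second k)
           (↦-resp-≈ (⊖-↦ ι-u↦φ (⊘-↦ {c = c} (⊖-↦ (⊕-↦ α[k+2] (⊗-↦ ι-u↦φ ι-v↦δ)) (⊗-↦ α[3k+2] β₁))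
                                            β₂ c-inverse))
                     a≈)
    α₃ : α u v (3 * suc k + 3) ↦ φ - a
    α₃ = unfold (α-third k) (⊖-↦ ι-u↦φ α₂)

  initial-block : Block 0
  initial-block = record
    { x = r₁ ; y = + 1 ; e = δ ; e⁻¹ = + 1 - δ
    ; α₁ = ι-[-u]↦-φ
    ; α₂ = ↦-resp-≈ (⊘-↦ {c = δ - + 1} α₂-numerator denominator -δ*[δ-1]≈1)
                    (≈-reflexive -φ*[δ-1]≡r₁)
    ; α₃ = ↦-resp-≈ (⊘-↦ {c = δ - + 1} (⊗-↦ ι-[-u]↦-φ (⊖-↦ ι-v↦δ (ι-↦ (+ 1)))) denominator
                         -δ*[δ-1]≈1)
                    α₃≈φ-r₁
    ; β₁ = ι-↦ (+ 1)
    ; β₂ = ↦-resp-≈ (⊖-↦ (⊗-↦ ι-u↦φ ι-u↦φ) ι-v↦δ) φ²-δ≈δ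
    ; β₃ = ↦-resp-≈ (⊘-↦ {c = (δ - + 1) ℤ.* (δ - + 1)} β₃-numerator (⊗-↦ denominator denominator)
                         (*-inverses { - δ} {δ - + 1} { - δ} {δ - + 1} -δ*[δ-1]≈1 -δ*[δ-1]≈1))
                    (≈-trans (≈-reflexive (ℤP.*-identityˡ _)) [δ-1]²≈-δ)
    ; x-root = inj₁ ≈-refl
    ; y-cases = inj₁ ≈-refl
    ; e-inverse = δ*[1-δ]≈1
    ; e-complement = inj₁ refl
    }
    where
    -φ*[δ-1]≡r₁ : - φ ℤ.* (δ - + 1) ≡ φ ℤ.* (+ 1 - δ)
    -φ*[δ-1]≡r₁ = solve (δ ∷ φ ∷ [])
    denominator : ι v ⊖ ι u ⊗ ι u ↦ - δ
    denominator = ↦-resp-≈ (⊖-↦ ι-v↦δ (⊗-↦ ι-u↦φ ι-u↦φ)) δ-φ²≈-δ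
    α₂-numerator : ι u ⊗ (ι (+ 2) ⊗ ι v ⊖ ι (+ 1) ⊖ ι u ⊗ ι u) ↦ - φ
    α₂-numerator =
      ↦-resp-≈ (⊗-↦ ι-u↦φ (⊖-↦ (⊖-↦ (⊗-↦ (ι-↦ (+ 2)) ι-v↦δ) (ι-↦ (+ 1))) (⊗-↦ ι-u↦φ ι-u↦φ)))
               α₂-numerator≈-φ
    β₃-numerator : ι u ⊗ ι u ⊕ ι u ⊗ ι u ⊗ ι u ⊗ ι u ⊕ ι v ⊗ ι v ⊗ ι v ⊖ ι (+ 3) ⊗ ι u ⊗ ι u ⊗ ι v
                   ↦ + 1
    β₃-numerator =
      ↦-resp-≈ (⊖-↦ (⊕-↦ (⊕-↦ (⊗-↦ ι-u↦φ ι-u↦φ) (⊗-↦ (⊗-↦ (⊗-↦ ι-u↦φ ι-u↦φ) ι-u↦φ) ι-u↦φ))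
                          (⊗-↦ (⊗-↦ ι-v↦δ ι-v↦δ) ι-v↦δ))
                    (⊗-↦ (⊗-↦ (⊗-↦ (ι-↦ (+ 3)) ι-u↦φ) ι-u↦φ) ι-v↦δ))
               β₃-numerator≈1

  infix 4 _⊑_

  _⊑_ : Maybe ℚ → Maybe ℚ → Set
  m ⊑ n = ∀ {z} → m ↦ z → n ↦ z

  -- Child c j: positions 1 and 2 of block 3j + c, which the recursion computes from block j.
  record Child₀ (j : ℕ) : Set where
    field
      α₂ : α u v (9 * j + 2) ↦ r₁
      β₁ : β u v (3 * j + 1) ⊑ β u v (9 * j + 1)
      β₂ : β u v (3 * j + 2) ⊑ β u v (9 * j + 2)

  record Child₁ (j : ℕ) : Set where
    field
      α₂ : α u v (3 * j + 3) ⊑ α u v (9 * j + 5)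
      β₁ : β u v (9 * j + 4) ↦ δ - + 1
      β₂ : β u v (9 * j + 5) ↦ + 1

  record Child₂ (j : ℕ) : Set where
    field
      α₂ : α u v (9 * j + 8) ↦ r₂
      β₁ : β u v (9 * j + 7) ↦ + 1
      β₂ : β u v (9 * j + 8) ↦ δ - + 1

  private
    index₀ : ∀ j r → 3 * (3 * j) + r ≡ 9 * j + r
    index₀ = solve-∀

    index₁ : ∀ j r → 3 * suc (3 * j) + r ≡ 9 * j + (3 + r)
    index₁ = solve-∀

    index₂ : ∀ j r → 3 * suc (suc (3 * j)) + r ≡ 9 * j + (6 + r)
    index₂ = solve-∀

    index₃ : ∀ j r → 3 * suc (suc (suc (3 * j))) + r ≡ 9 * suc j + r
    index₃ = solve-∀

    index-3j+3 : ∀ j → 3 * j + 3 ≡ suc (3 * j) + 2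
    index-3j+3 = solve-∀

    index-3j+4 : ∀ j → 3 * suc j + 1 ≡ suc (suc (3 * j)) + 2
    index-3j+4 = solve-∀

  first-child : ∀ j → Block j → Block (3 * j) → Child₀ j → Block (suc (3 * j)) × Child₁ j
  first-child j B B₀ C₀ = B₁ , record
    { α₂ = λ r → ↦-resp-≈ (reindex (α u v) (index₁ j 2) (Block.α₂ B₁)) (↦-unique B.α₃ r)
    ; β₁ = reindex (β u v) (index₁ j 1) (Block.β₁ B₁)
    ; β₂ = ↦-resp-≈ (reindex (β u v) (index₁ j 2) (Block.β₂ B₁)) (≈-reflexive δ-[δ-1]≡1)
    }
    where
    module B = Block B
    module C₀ = Child₀ C₀
    δ-[δ-1]≡1 : δ - (δ - + 1) ≡ + 1
    δ-[δ-1]≡1 = solve (δ ∷ [])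
    B₁ : Block (suc (3 * j))
    B₁ = block-step (3 * j) B.β₂ B.α₂
           (reindex (β u v) (sym (index₀ j 2)) (C₀.β₂ B.β₂)) B.e-inverse
           (Block.β₃ B₀) (reindex (α u v) (sym (index₀ j 2)) C₀.α₂)
           (*-inverse-cancel {B.e} {B.e⁻¹} (δ - + 1) B.e-inverse) (inj₂ ≈-refl)
           (complement-inverse (inj₂ ≈-refl))
           (child₁-α₂ B.x) (root-complement B.x-root)

  second-child : ∀ j → Block j → Block (suc (3 * j)) → Child₁ j →
                 Block (suc (suc (3 * j))) × Child₂ j
  second-child j B B₁ C₁ = B₂ , record
    { α₂ = reindex (α u v) (index₂ j 2) (Block.α₂ B₂)
    ; β₁ = reindex (β u v) (index₂ j 1) (Block.β₁ B₂)
    ; β₂ = reindex (β u v) (index₂ j 2) (Block.β₂ B₂)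
    }
    where
    module B = Block B
    module C₁ = Child₁ C₁
    B₂ : Block (suc (suc (3 * j)))
    B₂ = block-step (suc (3 * j))
           (reindex (β u v) (index-3j+3 j) B.β₃) (reindex (α u v) (index-3j+3 j) B.α₃)
           (reindex (β u v) (sym (index₁ j 2)) C₁.β₂) ≈-refl
           (Block.β₃ B₁) (reindex (α u v) (sym (index₁ j 2)) (C₁.α₂ B.α₃))
           (≈-trans (*-cong (≈-refl { - δ}) (*-identityʳ-≈ {δ - + 1} ≈-refl)) -δ*[δ-1]≈1)
           (inj₁ ≈-refl) (complement-inverse (inj₁ ≈-refl))
           (child₂-α₂ (φ - B.x)) (inj₂ ≈-refl)

  third-child : ∀ j → Block (suc j) → Block (suc (suc (3 * j))) → Child₂ j →
                Block (3 * suc j) × Child₀ (suc j)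
  third-child j B B₂ C₂ = subst Block (sym (ℕP.*-suc 3 j)) B₃ , record
    { α₂ = reindex (α u v) (index₃ j 2) (Block.α₂ B₃)
    ; β₁ = λ r → ↦-resp-≈ (reindex (β u v) (index₃ j 1) (Block.β₁ B₃)) (↦-unique B.β₁ r)
    ; β₂ = λ r → ↦-resp-≈ (reindex (β u v) (index₃ j 2) (Block.β₂ B₃))
                          (↦-unique (↦-resp-≈ B.β₂ (complement-of-suc B)) r)
    }
    where
    module B = Block B
    module C₂ = Child₂ C₂
    B₃ : Block (suc (suc (suc (3 * j))))
    B₃ = block-step (suc (suc (3 * j)))
           (reindex (β u v) (index-3j+4 j) B.β₁) (reindex (α u v) (index-3j+4 j) B.α₁)
           (reindex (β u v) (sym (index₂ j 2)) C₂.β₂) [δ-1]*-δ≈1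
           (Block.β₃ B₂) (reindex (α u v) (sym (index₂ j 2)) C₂.α₂)
           (*-identityʳ-≈ [δ-1]*-δ≈1) B.y-cases (complement-inverse B.y-cases)
           (child₀-α₂ B.y-cases) (inj₁ ≈-refl)

  record Invariant (j : ℕ) : Set where
    field
      blocks : ∀ m → m < 3 + 3 * j → Block m
      child₀ : Child₀ j
      child₁ : Child₁ j
      child₂ : Child₂ j

  private
    <3+-cases : ∀ {m} n → m < 3 + n → m < n ⊎ m ≡ n ⊎ m ≡ suc n ⊎ m ≡ suc (suc n)
    <3+-cases {zero} zero _ = inj₂ (inj₁ refl)
    <3+-cases {zero} (suc n) _ = inj₁ z<s
    <3+-cases {suc zero} zero _ = inj₂ (inj₂ (inj₁ refl))
    <3+-cases {suc (suc zero)} zero _ = inj₂ (inj₂ (inj₂ refl))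
    <3+-cases {suc (suc (suc m))} zero (s<s (s<s (s<s ())))
    <3+-cases {suc m} (suc n) (s<s m<3+n) =
      Sum.map s<s (Sum.map (cong suc) (Sum.map (cong suc) (cong suc))) (<3+-cases n m<3+n)

    1+n<3+3n : ∀ n → suc n < 3 + 3 * n
    1+n<3+3n n = s<s (s≤s (ℕP.m≤n⇒m≤1+n (ℕP.m≤n*m n 3)))

  initial-invariant : Invariant 0
  initial-invariant = record
    { blocks = blocks ; child₀ = C₀ ; child₁ = proj₂ first ; child₂ = proj₂ second }
    where
    C₀ : Child₀ 0
    C₀ = record { α₂ = Block.α₂ initial-block ; β₁ = λ r → r ; β₂ = λ r → r }
    first = first-child 0 initial-block initial-block C₀
    second = second-child 0 initial-block (proj₁ first) (proj₂ first)
    blocks : ∀ m → m < 3 → Block m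
    blocks 0 _ = initial-block
    blocks 1 _ = proj₁ first
    blocks 2 _ = proj₁ second
    blocks (suc (suc (suc m))) (s<s (s<s (s<s ())))

  next-invariant : ∀ {j} → Invariant j → Invariant (suc j)
  next-invariant {j} I = record
    { blocks = blocks′ ; child₀ = proj₂ third ; child₁ = proj₂ first ; child₂ = proj₂ second }
    where
    open Invariant I
    B : Block (suc j)
    B = blocks (suc j) (1+n<3+3n j)
    third = third-child j B (blocks (suc (suc (3 * j))) (ℕP.n<1+n _)) child₂
    first = first-child (suc j) B (proj₁ third) (proj₂ third)
    second = second-child (suc j) B (proj₁ first) (proj₂ first)
    blocks′ : ∀ m → m < 3 + 3 * suc j → Block m
    blocks′ m m<3+3[j+1] with <3+-cases (3 * suc j) m<3+3[j+1]
    ... | inj₁ m<3[j+1]             = blocks m (subst (m <_) (ℕP.*-suc 3 j) m<3[j+1])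
    ... | inj₂ (inj₁ refl)          = proj₁ third
    ... | inj₂ (inj₂ (inj₁ refl))   = proj₁ first
    ... | inj₂ (inj₂ (inj₂ refl))   = proj₁ second

  invariant : ∀ j → Invariant j
  invariant zero    = initial-invariant
  invariant (suc j) = next-invariant (invariant j)

  child₀ : ∀ j → Child₀ j
  child₀ j = Invariant.child₀ (invariant j)

  child₁ : ∀ j → Child₁ j
  child₁ j = Invariant.child₁ (invariant j)

  child₂ : ∀ j → Child₂ j
  child₂ j = Invariant.child₂ (invariant j)

  block : ∀ n → Block n
  block n = Invariant.blocks (invariant n) n (ℕP.<-trans (ℕP.n<1+n n) (1+n<3+3n n))

  private
    a+[b-a]≡b : ∀ a b → a ℤ.+ (b - a) ≡ b
    a+[b-a]≡b a b = solve (a ∷ b ∷ [])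

  α-pair-sum : ∀ k → α u v (3 * k + 2) ⊕ α u v (3 * k + 3) ↦ φ
  α-pair-sum k = ↦-resp-≈ (⊕-↦ (Block.α₂ (block k)) (Block.α₃ (block k)))
                          (≈-reflexive (a+[b-a]≡b (Block.x (block k)) φ))

  next-β₁ : ∀ k → β u v (3 * k + 4) ↦ Block.y (block (suc k))
  next-β₁ k = reindex (β u v) (next-block k 1) (Block.β₁ (block (suc k)))

  next-β₂ : ∀ k → β u v (3 * k + 5) ↦ δ - Block.y (block (suc k))
  next-β₂ k = reindex (β u v) (next-block k 2)
                (↦-resp-≈ (Block.β₂ (block (suc k))) (complement-of-suc (block (suc k))))

  β-pair-sum : ∀ k → β u v (3 * k + 4) ⊕ β u v (3 * k + 5) ↦ δ
  β-pair-sum k = ↦-resp-≈ (⊕-↦ (next-β₁ k) (next-β₂ k))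
                          (≈-reflexive (a+[b-a]≡b (Block.y (block (suc k))) δ))

lemma5 : (p : ℕ) → Prime p → p ≢ 2 →
    (δ φ : ℤ) → (δ ℤ.* δ - δ ℤ.+ + 1) ≡ + 0 [mod p ] →
    (φ ℤ.* φ) ≡ + 2 ℤ.* δ [mod p ] →
    (δ⁻¹ : ℤ) → (δ ℤ.* δ⁻¹) ≡ + 1 [mod p ] →
    (u v : ℤ) → u ≡ φ [mod p ] → v ≡ δ [mod p ] →
    (β u v 1 ≋ ι (+ 1) [mod p ] × β u v 2 ≋ ι δ [mod p ])
    × ((k : ℕ) →
        α u v (3 * k + 1) ≋ ι (- φ) [mod p ]
        × (DefZp p (α u v (3 * k + 2)) × DefZp p (α u v (3 * k + 3))
           × α u v (3 * k + 2) ⊕ α u v (3 * k + 3) ≋ ι φ [mod p ])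
        × α u v (9 * k + 2) ≋ ι (φ ℤ.* δ⁻¹) [mod p ]
        × α u v (9 * k + 5) ≋ α u v (3 * k + 3) [mod p ]
        × α u v (9 * k + 8) ≋ ι (φ ℤ.* δ) [mod p ]
        × β u v (3 * k + 3) ≋ ι (- δ) [mod p ]
        × (DefZp p (β u v (3 * k + 4)) × DefZp p (β u v (3 * k + 5))
           × β u v (3 * k + 4) ⊕ β u v (3 * k + 5) ≋ ι δ [mod p ])
        × β u v (9 * k + 1) ≋ β u v (3 * k + 1) [mod p ]
        × β u v (9 * k + 4) ≋ ι (- δ⁻¹) [mod p ]
        × β u v (9 * k + 7) ≋ ι (+ 1) [mod p ])
lemma5 p p-prime _ δ φ δ²-δ+1≡0 φ²≡2δ δ⁻¹ δδ⁻¹≡1 u v u≡φ v≡δ =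
  (↦⇒≋ (Block.β₁ initial-block) (ι-↦ (+ 1)) , ↦⇒≋ (Block.β₂ initial-block) (ι-↦ δ)) ,
  λ k → ↦⇒≋ (Block.α₁ (block k)) (ι-↦ (- φ))
      , (↦⇒DefZp (Block.α₂ (block k)) , ↦⇒DefZp (Block.α₃ (block k)) , ↦⇒≋ (α-pair-sum k) (ι-↦ φ))
      , ↦⇒≋ (↦-resp-≈ (Child₀.α₂ (child₀ k)) (r₁≈φ*δ⁻¹ δδ⁻¹≈1)) (ι-↦ (φ ℤ.* δ⁻¹))
      , ↦⇒≋ (Child₁.α₂ (child₁ k) (Block.α₃ (block k))) (Block.α₃ (block k))
      , ↦⇒≋ (Child₂.α₂ (child₂ k)) (ι-↦ (φ ℤ.* δ))
      , ↦⇒≋ (Block.β₃ (block k)) (ι-↦ (- δ))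
      , (↦⇒DefZp (next-β₁ k) , ↦⇒DefZp (next-β₂ k) , ↦⇒≋ (β-pair-sum k) (ι-↦ δ))
      , ↦⇒≋ (Child₀.β₁ (child₀ k) (Block.β₁ (block k))) (Block.β₁ (block k))
      , ↦⇒≋ (↦-resp-≈ (Child₁.β₁ (child₁ k)) (δ-1≈-δ⁻¹ δδ⁻¹≈1)) (ι-↦ (- δ⁻¹))
      , ↦⇒≋ (Child₂.β₁ (child₂ k)) (ι-↦ (+ 1))
  where
  open Congruence p
  open Reduction p p-prime
  open Residues p δ φ δ²-δ+1≡0 φ²≡2δ
  open Blocks p p-prime δ φ u v δ²-δ+1≡0 φ²≡2δ u≡φ v≡δ
  δδ⁻¹≈1 : δ ℤ.* δ⁻¹ ≈ + 1
  δδ⁻¹≈1 = ≡[mod]⇒≈ {δ ℤ.* δ⁻¹} δδ⁻¹≡1
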